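{- Let $\phi=\frac{1+\sqrt5}{2}$ and let $g:\mathbb{Z}_{\geq 0}\to\{0,1\}$ be defined by $g(0)=1$, $g(1)=0$ and, for $n\ge 2$, $g(n)=1-g(m)$ if there is $m\in\mathbb{Z}_{\geq0}$ with $\lfloor n\phi\rfloor=\lfloor m(\phi+1)\rfloor+1$, and $g(n)=1$ otherwise. Let $P_{1,1}=\{(\lfloor n\phi\rfloor+g(n)-1,\ \lfloor n(\phi+1)\rfloor+g(n)) : n\in\mathbb{Z}_{\geq0}\}$, $P_{1,2}=\{(\lfloor n(\phi+1)\rfloor+g(n),\ \lfloor n\phi\rfloor+g(n)-1) : n\in\mathbb{Z}_{\geq0}\}$ and $P_1=P_{1,1}\cup P_{1,2}\cup\{(0,0),(1,1)\}$. Then the set of $\mathcal{P}$-positions of the variant of Wythoff's game with terminal set $T=\{(x,y):x+y\le 2\}$ (described in the context) is exactly $P_1$.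
   Context: Wythoff's game moves: from a position $(x,y)\in\mathbb{Z}_{\geq0}^2$ a player may move to any $(u,y)$ with $0\le u<x$, any $(x,v)$ with $0\le v<y$, or any $(x-t,y-t)$ with $1\le t\le\min(x,y)$. In the variant considered here, the play is the same, but the game ends as soon as the position lies in the terminal set $T=\{(x,y):x+y\le 2\}=\{(0,0),(1,0),(0,1),(1,1),(2,0),(0,2)\}$; positions in $T$ have no moves, and the player who moves the position into $T$ wins (normal play). Two players alternate. A $\mathcal{P}$-position is a position from which the previous player (the one who has just moved) wins with correct play; an $\mathcal{N}$-position is one from which the next player wins. -}

module Defs where

open import Data.Nat using (ℕ; zero; suc; _+_; _*_; _∸_; _≤_; _<_; _≤ᵇ_)
open import Data.Bool using (Bool; true; false; if_then_else_)
open import Data.Product using (_×_; ∃-syntax; _,_)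
open import Data.Sum using (_⊎_)
open import Data.Empty using (⊥)
open import Relation.Binary.PropositionalEquality using (_≡_)

-- φ = (1 + √5)/2.  For k n : ℕ,   k ≤ n·φ  ⇔  2k − n ≤ n·√5  ⇔  (2k ∸ n)² ≤ 5n²
-- (exact integer test, no rounding involved).
leMulPhiᵇ : ℕ → ℕ → Bool
leMulPhiᵇ k n = ((2 * k ∸ n) * (2 * k ∸ n)) ≤ᵇ (5 * (n * n))

countLe : ℕ → ℕ → ℕ
countLe zero    n = 0
countLe (suc b) n = (if leMulPhiᵇ (suc b) n then 1 else 0) + countLe b n

-- ⌊ n φ ⌋ = #{ k ≥ 1 : k ≤ n φ } ; since n φ < 2n it suffices to count k ≤ 2n.
⌊_φ⌋ : ℕ → ℕ
⌊ n φ⌋ = countLe (2 * n) n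

⌊_φ+1⌋ : ℕ → ℕ
⌊ n φ+1⌋ = ⌊ n φ⌋ + n

IsG : (ℕ → ℕ) → Set
IsG g =
  (g 0 ≡ 1) × (g 1 ≡ 0) ×
  (∀ n → 2 ≤ n →
     (∀ m → ⌊ n φ⌋ ≡ ⌊ m φ+1⌋ + 1 → g n ≡ 1 ∸ g m) ×
     ((∀ m → ⌊ n φ⌋ ≡ ⌊ m φ+1⌋ + 1 → ⊥) → g n ≡ 1))

-- Terminal set T = {(x,y) : x + y ≤ 2}; moves exist only from positions outside T.
data Move : ℕ → ℕ → ℕ → ℕ → Set where
  horiz : ∀ {x y u} → 2 < x + y → u < x → Move x y u y
  vert  : ∀ {x y v} → 2 < x + y → v < y → Move x y x v
  diag  : ∀ {x y t} → 2 < x + y → 1 ≤ t → t ≤ x → t ≤ y → Move x y (x ∸ t) (y ∸ t)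

-- P- and N-positions (normal play), as the least solution of the usual recursion
-- (the game is finite, so every position is exactly one of them).
data IsP (x y : ℕ) : Set
data IsN (x y : ℕ) : Set

data IsP x y where
  isP : (∀ u v → Move x y u v → IsN u v) → IsP x y

data IsN x y where
  isN : ∀ u v → Move x y u v → IsP u v → IsN x y

-- P₁,₁, P₁,₂ and P₁ (the "−1" is moved to the other side to stay in ℕ).
InP11 : (ℕ → ℕ) → ℕ → ℕ → Set
InP11 g x y = ∃[ n ] ((x + 1 ≡ ⌊ n φ⌋ + g n) × (y ≡ ⌊ n φ+1⌋ + g n))

InP12 : (ℕ → ℕ) → ℕ → ℕ → Set
InP12 g x y = ∃[ n ] ((x ≡ ⌊ n φ+1⌋ + g n) × (y + 1 ≡ ⌊ n φ⌋ + g n))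

InP1 : (ℕ → ℕ) → ℕ → ℕ → Set
InP1 g x y = InP11 g x y ⊎ InP12 g x y ⊎ ((x ≡ 0) × (y ≡ 0)) ⊎ ((x ≡ 1) × (y ≡ 1))

{-# OPTIONS --safe #-}
module Submission where

-- Write a n = ⌊nφ⌋ and b n = ⌊n(φ+1)⌋ = a n + n.  Comparisons with multiples of φ are exact
-- integer inequalities (p < qφ iff p² < pq + q²), which yields the floor characterisation and
-- Beatty's theorem: the values a n and b n (n ≥ 1) partition the positive integers.  For n ≥ 2,
-- g n = 0 exactly when a n = b m + 1 with g m = 1, and then the pairs n and m trade the adjacent
-- values b m, a n.  So α n = a n + g n and β n = b n + g n still satisfy β n = (α n − 1) + n + 1,
-- α is strictly increasing, and the α n − 1 and β n (n ≥ 2) partition {3, 4, …}.  That is all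
-- Wythoff's argument needs: T with the pairs (α n − 1, β n) and their mirror images admits no move
-- inside it (a move keeps the row, the column or the difference y − x, each of which determines n)
-- and can be reached from every other position, so it is the set of P-positions.

open import Defs
open import Data.Bool using (true; false; T)
open import Data.Empty using (⊥; ⊥-elim)
open import Data.List.Base using (_∷_; [])
open import Data.Nat
open import Data.Nat.Induction using (<-wellFounded)
open import Data.Nat.Properties
open import Algebra.Properties.CommutativeSemigroup +-commutativeSemigroup using (xy∙z≈xz∙y)
open import Data.Nat.Tactic.RingSolver using (solve-∀; solve)
open import Data.Product using (_×_; _,_; proj₁; proj₂; ∃-syntax)
open import Data.Sum using (_⊎_; inj₁; inj₂)
import Data.Sum as Sum
open import Data.Unit using (tt)
open import Function.Bundles using (_⇔_; mk⇔; module Equivalence)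
open import Induction.WellFounded using (Acc; acc)
open import Relation.Binary.Definitions using (tri<; tri≈; tri>)
open import Relation.Binary.PropositionalEquality
open import Relation.Nullary using (¬_; Dec; yes; no; contradiction)
open import Relation.Nullary.Decidable using (map′)
open import Relation.Unary using (Decidable)

open Equivalence using (to; from)

<-exchange : ∀ {x y u v} → x + v ≡ y + u → x < y ⇔ u < v
<-exchange {x} {y} {u} {v} eq = mk⇔
  (λ x<y → +-cancelˡ-< y u v (subst (_< y + v) eq (+-monoˡ-< v x<y)))
  (λ u<v → +-cancelʳ-< v x y (subst (_< y + v) (sym eq) (+-monoʳ-< y u<v)))

≤-exchange : ∀ {x y u v} → x + v ≡ y + u → x ≤ y ⇔ u ≤ v
≤-exchange {x} {y} {u} {v} eq = mk⇔
  (λ x≤y → +-cancelˡ-≤ y u v (subst (_≤ y + v) eq (+-monoˡ-≤ v x≤y)))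
  (λ u≤v → +-cancelʳ-≤ v x y (subst (_≤ y + v) (sym eq) (+-monoʳ-≤ y u≤v)))

≡-exchange : ∀ {x y u v} → x + v ≡ y + u → x ≡ y → v ≡ u
≡-exchange {x} {y} {u} {v} eq refl = +-cancelˡ-≡ x v u eq

stepwise⇒strictMono : ∀ (f : ℕ → ℕ) {n₀} → (∀ {n} → n₀ ≤ n → f n < f (suc n)) →
                      ∀ {m n} → n₀ ≤ m → m < n → f m < f n
stepwise⇒strictMono f step {m} {suc n} n₀≤m (s≤s m≤n) with m≤n⇒m<n∨m≡n m≤n
... | inj₂ refl = step n₀≤m
... | inj₁ m<n  = <-trans (stepwise⇒strictMono f step n₀≤m m<n) (step (≤-trans n₀≤m (<⇒≤ m<n)))

strictMono⇒injective : ∀ (f : ℕ → ℕ) {n₀} → (∀ {m n} → n₀ ≤ m → m < n → f m < f n) →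
                       ∀ {m n} → n₀ ≤ m → n₀ ≤ n → f m ≡ f n → m ≡ n
strictMono⇒injective f mono {m} {n} n₀≤m n₀≤n eq with <-cmp m n
... | tri< m<n _ _ = contradiction eq (<⇒≢ (mono n₀≤m m<n))
... | tri≈ _ m≡n _ = m≡n
... | tri> _ _ n<m = contradiction (sym eq) (<⇒≢ (mono n₀≤n n<m))

crossing : ∀ {P : ℕ → Set} → Decidable P → P 0 → ∀ {N} → ¬ P N → ∃[ k ] P k × ¬ P (suc k)
crossing P? p₀ {zero}  ¬p₀ = contradiction p₀ ¬p₀
crossing P? p₀ {suc N} ¬pN+1 with P? N
... | yes pN = N , pN , ¬pN+1
... | no ¬pN = crossing P? p₀ ¬pN

-- Comparison with multiples of φ

-- φ is the positive root of x² = x + 1 and the other root is negative, so p < qφ iff p² < pq + q².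
infix 4 _<_·φ _>_·φ _≤_·φ

_<_·φ : ℕ → ℕ → Set
p < q ·φ = p * p < p * q + q * q

_>_·φ : ℕ → ℕ → Set
p > q ·φ = p * q + q * q < p * p

_≤_·φ : ℕ → ℕ → Set
p ≤ q ·φ = p * p ≤ p * q + q * q

φ-swap-identity : ∀ q r → (q + r) * (q + r) + q * q ≡ ((q + r) * q + q * q) + (q * r + r * r)
φ-swap-identity = solve-∀

-- (q + r)/q < φ iff q/r > φ, because 1/(φ − 1) = φ.
+<·φ⇔>·φ : ∀ q r → q + r < q ·φ ⇔ q > r ·φ
+<·φ⇔>·φ q r = <-exchange (φ-swap-identity q r)

+>·φ⇔<·φ : ∀ q r → q + r > q ·φ ⇔ q < r ·φ
+>·φ⇔<·φ q r = <-exchange (sym (φ-swap-identity q r))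

-- Descent: a solution (q + r, q) yields the smaller solution (q, r).
φ-irrational : ∀ {p q} → 1 ≤ q → p * p ≢ p * q + q * q
φ-irrational {p} = descent (<-wellFounded p)
  where
  descent : ∀ {p q} → Acc _<_ p → 1 ≤ q → p * p ≢ p * q + q * q
  descent {p} {q} (acc rec) 1≤q eq with q <? p
  ... | no q≮p = <-irrefl eq (begin-strict
        p * p          ≤⟨ *-monoʳ-≤ p (≮⇒≥ q≮p) ⟩
        p * q          <⟨ m<m+n (p * q) (*-mono-≤ 1≤q 1≤q) ⟩
        p * q + q * q  ∎)
    where open ≤-Reasoning
  ... | yes q<p = descent (rec q<p) (m<n⇒0<n∸m q<p) (≡-exchange (φ-swap-identity q r) eq′)
    where
    r = p ∸ q
    eq′ : (q + r) * (q + r) ≡ (q + r) * q + q * q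
    eq′ = subst (λ s → s * s ≡ s * q + q * q) (sym (m+[n∸m]≡n (<⇒≤ q<p))) eq

<·φ⊎>·φ : ∀ p {q} → 1 ≤ q → p < q ·φ ⊎ p > q ·φ
<·φ⊎>·φ p {q} 1≤q with <-cmp (p * p) (p * q + q * q)
... | tri< lt _ _ = inj₁ lt
... | tri≈ _ eq _ = ⊥-elim (φ-irrational {p} 1≤q eq)
... | tri> _ _ gt = inj₂ gt

<·φ-monoʳ : ∀ {p q q′} → q ≤ q′ → p < q ·φ → p < q′ ·φ
<·φ-monoʳ {p} q≤q′ lt = <-≤-trans lt (+-mono-≤ (*-monoʳ-≤ p q≤q′) (*-mono-≤ q≤q′ q≤q′))

>·φ∧<·φ⇒< : ∀ {p q q′} → p > q ·φ → p < q′ ·φ → q < q′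
>·φ∧<·φ⇒< {p} gt lt = ≰⇒> λ q′≤q → <-asym gt (<·φ-monoʳ {p} q′≤q lt)

>·φ⇒> : ∀ {p q} → p > q ·φ → q < p
>·φ⇒> {p} {q} gt = ≰⇒> λ p≤q →
  <⇒≱ gt (≤-trans (*-monoʳ-≤ p p≤q) (m≤m+n (p * q) (q * q)))

>0·φ : ∀ {p} → 1 ≤ p → p > 0 ·φ
>0·φ {p} 1≤p = subst (_< p * p) (sym (trans (+-identityʳ (p * 0)) (*-zeroʳ p))) (*-mono-≤ 1≤p 1≤p)

≤·φ⇒≤2* : ∀ {p q} → p ≤ q ·φ → p ≤ 2 * q
≤·φ⇒≤2* {p} {q} le with p ≤? 2 * q
... | yes p≤2q = p≤2q
... | no p≰2q = contradiction le (<⇒≱ (begin-strict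
      p * q + q * q  ≤⟨ +-monoʳ-≤ (p * q) (*-monoˡ-≤ q q≤p) ⟩
      p * q + p * q  ≡⟨ solve (p ∷ q ∷ []) ⟩
      p * (2 * q)    <⟨ *-monoʳ-< p {{>-nonZero (≤-<-trans z≤n 2q<p)}} 2q<p ⟩
      p * p          ∎))
  where
  open ≤-Reasoning
  2q<p = ≰⇒> p≰2q
  q≤p = ≤-trans (m≤m+n q (q + 0)) (<⇒≤ 2q<p)

≤·φ-suc : ∀ {p q} → p ≤ q ·φ → suc p ≤ suc q ·φ
≤·φ-suc {p} {q} le = begin
  suc p * suc p                                ≡⟨ solve (p ∷ []) ⟩
  p * p + (p + suc p)                          ≤⟨ +-mono-≤ le (+-monoʳ-≤ p (s≤s p≤3q+1)) ⟩
  (p * q + q * q) + (p + suc (suc (3 * q)))    ≡⟨ solve (p ∷ q ∷ []) ⟩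
  suc p * suc q + suc q * suc q                ∎
  where
  open ≤-Reasoning
  p≤3q+1 : p ≤ suc (3 * q)
  p≤3q+1 = ≤-trans (≤·φ⇒≤2* {p} le) (m≤n⇒m≤1+n (*-monoˡ-≤ q {2} {3} (s≤s (s≤s z≤n))))

leMulPhiᵇ-mono : ∀ {k k′ n} → k ≤ k′ → T (leMulPhiᵇ k′ n) → T (leMulPhiᵇ k n)
leMulPhiᵇ-mono {n = n} k≤k′ t = ≤⇒≤ᵇ (≤-trans (*-mono-≤ d≤d′ d≤d′) (≤ᵇ⇒≤ _ _ t))
  where d≤d′ = ∸-monoˡ-≤ n (*-monoʳ-≤ 2 k≤k′)

-- The identity 4 (k² − kn − n²) = d² − 5n² for d = 2k − n, with all subtractions moved across.
scaled-identity : ∀ k n d → 2 * k ≡ n + d → 4 * (k * k) + 5 * (n * n) ≡ 4 * (k * n + n * n) + d * d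
scaled-identity k n d 2k≡n+d = begin
  4 * (k * k) + 5 * (n * n)                ≡⟨ solve (k ∷ n ∷ []) ⟩
  (2 * k) * (2 * k) + 5 * (n * n)          ≡⟨ cong (λ s → s * s + 5 * (n * n)) 2k≡n+d ⟩
  (n + d) * (n + d) + 5 * (n * n)          ≡⟨ solve (n ∷ d ∷ []) ⟩
  d * d + (2 * n * (n + d) + 4 * (n * n))
    ≡⟨ cong (λ s → d * d + (2 * n * s + 4 * (n * n))) (sym 2k≡n+d) ⟩
  d * d + (2 * n * (2 * k) + 4 * (n * n))  ≡⟨ solve (k ∷ n ∷ d ∷ []) ⟩
  4 * (k * n + n * n) + d * d              ∎
  where open ≡-Reasoning

leMulPhiᵇ⇔≤·φ : ∀ k n → T (leMulPhiᵇ k n) ⇔ k ≤ n ·φ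
leMulPhiᵇ⇔≤·φ k n with 2 * k ≤? n
... | yes 2k≤n = mk⇔ (λ _ → k≤n·φ) (λ _ → fits)
  where
  fits : T (leMulPhiᵇ k n)
  fits = subst (λ d → T (d * d ≤ᵇ 5 * (n * n))) (sym (m≤n⇒m∸n≡0 2k≤n)) (≤⇒≤ᵇ {0} {5 * (n * n)} z≤n)
  k≤n·φ : k ≤ n ·φ
  k≤n·φ = ≤-trans (*-monoʳ-≤ k (≤-trans (m≤m+n k (k + 0)) 2k≤n)) (m≤m+n (k * n) (n * n))
... | no 2k≰n = mk⇔
  (λ t → *-cancelˡ-≤ 4 (from (≤-exchange scaled) (≤ᵇ⇒≤ _ _ t)))
  (λ le → ≤⇒≤ᵇ (to (≤-exchange scaled) (*-monoʳ-≤ 4 le)))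
  where
  d = 2 * k ∸ n
  scaled = scaled-identity k n d (sym (m+[n∸m]≡n (<⇒≤ (≰⇒> 2k≰n))))

-- Immediate for the form (2k ∸ n)² ≤ 5n² used in Defs, not for the quadratic form.
≤-≤·φ-trans : ∀ {p p′ q} → p ≤ p′ → p′ ≤ q ·φ → p ≤ q ·φ
≤-≤·φ-trans {p} {p′} {q} p≤p′ le =
  to (leMulPhiᵇ⇔≤·φ p q) (leMulPhiᵇ-mono {n = q} p≤p′ (from (leMulPhiᵇ⇔≤·φ p′ q) le))

countLe-≤ : ∀ b n → countLe b n ≤ b
countLe-≤ zero    n = z≤n
countLe-≤ (suc b) n with leMulPhiᵇ (suc b) n
... | true  = s≤s (countLe-≤ b n)
... | false = m≤n⇒m≤1+n (countLe-≤ b n)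

countLe-spec : ∀ b n →
  T (leMulPhiᵇ (countLe b n) n) × (T (leMulPhiᵇ (suc (countLe b n)) n) → countLe b n ≡ b)
countLe-spec zero n = from (leMulPhiᵇ⇔≤·φ 0 n) z≤n , λ _ → refl
countLe-spec (suc b) n with leMulPhiᵇ (suc b) n in eq | countLe-spec b n
... | true  | _    , maximal = next-fits , λ _ → cong suc (maximal next-fits)
  where next-fits = leMulPhiᵇ-mono {n = n} (s≤s (countLe-≤ b n)) (subst T (sym eq) tt)
... | false | fits , maximal = fits , λ next-fits →
  ⊥-elim (subst T eq (subst (λ c → T (leMulPhiᵇ (suc c) n)) (maximal next-fits) next-fits))

-- The Beatty sequences ⌊nφ⌋ and ⌊n(φ+1)⌋

⌊⌋-≤·φ : ∀ n → ⌊ n φ⌋ ≤ n ·φ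
⌊⌋-≤·φ n = to (leMulPhiᵇ⇔≤·φ ⌊ n φ⌋ n) (proj₁ (countLe-spec (2 * n) n))

suc⌊⌋->·φ : ∀ n → suc ⌊ n φ⌋ > n ·φ
suc⌊⌋->·φ n = ≰⇒> λ fits →
  1+n≰n (≤·φ⇒≤2* {suc (2 * n)} {n} (subst (λ c → suc c ≤ n ·φ) (⌊⌋≡2n fits) fits))
  where
  ⌊⌋≡2n : suc ⌊ n φ⌋ ≤ n ·φ → ⌊ n φ⌋ ≡ 2 * n
  ⌊⌋≡2n fits = proj₂ (countLe-spec (2 * n) n) (from (leMulPhiᵇ⇔≤·φ (suc ⌊ n φ⌋) n) fits)

⌊⌋-<·φ : ∀ {n} → 1 ≤ n → ⌊ n φ⌋ < n ·φ
⌊⌋-<·φ {n} 1≤n = ≤∧≢⇒< (⌊⌋-≤·φ n) (φ-irrational {⌊ n φ⌋} 1≤n)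

≤·φ⇒≤⌊⌋ : ∀ {k n} → k ≤ n ·φ → k ≤ ⌊ n φ⌋
≤·φ⇒≤⌊⌋ {k} {n} fits = ≮⇒≥ λ ⌊⌋<k → <⇒≱ (suc⌊⌋->·φ n) (≤-≤·φ-trans {q = n} ⌊⌋<k fits)

>·φ⇒⌊⌋< : ∀ {k n} → k > n ·φ → ⌊ n φ⌋ < k
>·φ⇒⌊⌋< {k} {n} above = ≰⇒> λ k≤⌊⌋ → <⇒≱ above (≤-≤·φ-trans {q = n} k≤⌊⌋ (⌊⌋-≤·φ n))

⌊⌋-unique : ∀ {k n} → k < n ·φ → suc k > n ·φ → ⌊ n φ⌋ ≡ k
⌊⌋-unique {k} {n} below above =
  ≤-antisym (≤-pred (>·φ⇒⌊⌋< {suc k} {n} above)) (≤·φ⇒≤⌊⌋ {k} {n} (<⇒≤ below))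

⌊⌋-suc : ∀ n → suc ⌊ n φ⌋ ≤ ⌊ suc n φ⌋
⌊⌋-suc n = ≤·φ⇒≤⌊⌋ {n = suc n} (≤·φ-suc {⌊ n φ⌋} {n} (⌊⌋-≤·φ n))

⌊⌋-strictMono : ∀ {m n} → m < n → ⌊ m φ⌋ < ⌊ n φ⌋
⌊⌋-strictMono = stepwise⇒strictMono ⌊_φ⌋ (λ {n} _ → ⌊⌋-suc n) z≤n

⌊⌋+1-strictMono : ∀ {m n} → m < n → 2 + ⌊ m φ+1⌋ ≤ ⌊ n φ+1⌋
⌊⌋+1-strictMono {m} {n} m<n =
  subst (_≤ ⌊ n φ+1⌋) (cong suc (+-suc ⌊ m φ⌋ m)) (+-mono-≤ (⌊⌋-strictMono m<n) m<n)

⌊⌋+1-injective : ∀ {m n} → ⌊ m φ+1⌋ ≡ ⌊ n φ+1⌋ → m ≡ n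
⌊⌋+1-injective =
  strictMono⇒injective ⌊_φ+1⌋ (λ _ m<n → ≤-trans (n≤1+n _) (⌊⌋+1-strictMono m<n)) z≤n z≤n

⌊⌋+1≢suc : ∀ m n → ⌊ n φ+1⌋ ≢ suc ⌊ m φ+1⌋
⌊⌋+1≢suc m n eq with <-cmp m n
... | tri< m<n _ _ = 1+n≰n (subst (2 + ⌊ m φ+1⌋ ≤_) eq (⌊⌋+1-strictMono m<n))
... | tri≈ _ refl _ = <-irrefl eq (n<1+n _)
... | tri> _ _ n<m =
  1+n≰n (≤-trans (m≤n+m _ 2) (subst (λ b → 2 + b ≤ ⌊ m φ+1⌋) eq (⌊⌋+1-strictMono n<m)))

-- With j = ⌊mφ⌋ and k = j + m, the swap lemmas give jφ < k and k + 1 < (j + 1)φ,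
-- so ⌊nφ⌋ = k would force j < n < j + 1.
beatty-disjoint : ∀ {n m} → 1 ≤ n → ⌊ n φ⌋ ≢ ⌊ m φ+1⌋
beatty-disjoint {n} {zero} 1≤n eq = <⇒≢ (⌊⌋-strictMono 1≤n) (sym eq)
beatty-disjoint {n} {m@(suc _)} 1≤n eq = <⇒≱ j<n (≤-pred n<j+1)
  where
  j = ⌊ m φ⌋
  k-above : ⌊ m φ+1⌋ > j ·φ
  k-above = from (+>·φ⇔<·φ j m) (⌊⌋-<·φ {m} (s≤s z≤n))
  k+1-below : suc ⌊ m φ+1⌋ < suc j ·φ
  k+1-below = from (+<·φ⇔>·φ (suc j) m) (suc⌊⌋->·φ m)
  j<n : j < n
  j<n = >·φ∧<·φ⇒< {⌊ m φ+1⌋} k-above (subst (_< n ·φ) eq (⌊⌋-<·φ 1≤n))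
  n<j+1 : n < suc j
  n<j+1 = >·φ∧<·φ⇒< {suc ⌊ m φ+1⌋} (subst (λ k → suc k > n ·φ) eq (suc⌊⌋->·φ n)) k+1-below

beatty-cover : ∀ {k} → 1 ≤ k → (∃[ n ] ⌊ n φ⌋ ≡ k) ⊎ (∃[ m ] ⌊ m φ+1⌋ ≡ k)
beatty-cover {k} 1≤k
  with crossing (λ q → k * q + q * q <? k * k) (>0·φ 1≤k) (λ k>kφ → <-irrefl refl (>·φ⇒> {k} k>kφ))
... | n , k>nφ , k≯[n+1]φ with <·φ⊎>·φ (suc k) {suc n} (s≤s z≤n)
...   | inj₂ k+1>[n+1]φ = inj₁ (suc n , ⌊⌋-unique {k} k<[n+1]φ k+1>[n+1]φ)
  where
  k<[n+1]φ : k < suc n ·φ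
  k<[n+1]φ with <·φ⊎>·φ k {suc n} (s≤s z≤n)
  ... | inj₁ below = below
  ... | inj₂ above = contradiction above k≯[n+1]φ
...   | inj₁ k+1<[n+1]φ = inj₂ (m , trans (cong (_+ m) ⌊mφ⌋≡n) n+m≡k)
  where
  m = k ∸ n
  n+m≡k : n + m ≡ k
  n+m≡k = m+[n∸m]≡n (<⇒≤ (>·φ⇒> {k} k>nφ))
  ⌊mφ⌋≡n : ⌊ m φ⌋ ≡ n
  ⌊mφ⌋≡n = ⌊⌋-unique {n} {m}
    (to (+>·φ⇔<·φ n m) (subst (_> n ·φ) (sym n+m≡k) k>nφ))
    (to (+<·φ⇔>·φ (suc n) m) (subst (λ k → suc k < suc n ·φ) (sym n+m≡k) k+1<[n+1]φ))

-- Moves and kernels of the move graph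

Move-sym : ∀ {x y u v} → Move x y u v → Move y x v u
Move-sym {x} {y} (horiz big u<x)         = vert (subst (2 <_) (+-comm x y) big) u<x
Move-sym {x} {y} (vert big v<y)          = horiz (subst (2 <_) (+-comm x y) big) v<y
Move-sym {x} {y} (diag big 1≤t t≤x t≤y) = diag (subst (2 <_) (+-comm x y) big) 1≤t t≤y t≤x

Move⇒2< : ∀ {x y u v} → Move x y u v → 2 < x + y
Move⇒2< (horiz big _)    = big
Move⇒2< (vert big _)     = big
Move⇒2< (diag big _ _ _) = big

Move-decreasing : ∀ {x y u v} → Move x y u v → u + v < x + y
Move-decreasing {y = y} (horiz _ u<x)                 = +-monoˡ-< y u<x
Move-decreasing {x}     (vert _ v<y)                  = +-monoʳ-< x v<y
Move-decreasing {x} {y} (diag {t = t} _ 1≤t t≤x _) =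
  +-mono-<-≤ (∸-monoʳ-< {x} {t} {0} 1≤t t≤x) (m∸n≤m y t)

diag-move : ∀ {x y u v t} → 2 < x + y → 1 ≤ t → u + t ≡ x → v + t ≡ y → Move x y u v
diag-move {u = u} {v} {t} big 1≤t refl refl =
  subst₂ (Move _ _) (m+n∸n≡m u t) (m+n∸n≡m v t) (diag big 1≤t (m≤n+m t u) (m≤n+m t v))

Independent : (ℕ → ℕ → Set) → Set
Independent K = ∀ {x y u v} → K x y → Move x y u v → ¬ K u v

MovesInto : (ℕ → ℕ → Set) → ℕ → ℕ → Set
MovesInto K x y = ∃[ u ] ∃[ v ] Move x y u v × K u v

Absorbing : (ℕ → ℕ → Set) → Set
Absorbing K = ∀ x y → K x y ⊎ MovesInto K x y

IsP⇒¬IsN : ∀ {x y} → IsP x y → ¬ IsN x y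
IsP⇒¬IsN (isP allN) (isN u v mv p) = IsP⇒¬IsN p (allN u v mv)

module _ {K : ℕ → ℕ → Set} (independent : Independent K) (absorbing : Absorbing K) where

  kernel⇒IsP : ∀ {x y} → K x y → IsP x y
  kernel⇒IsP {x} {y} = go (<-wellFounded (x + y))
    where
    go : ∀ {x y} → Acc _<_ (x + y) → K x y → IsP x y
    go {x} {y} (acc rec) k = isP λ u v mv → reply mv (absorbing u v)
      where
      reply : ∀ {u v} → Move x y u v → K u v ⊎ MovesInto K u v → IsN u v
      reply mv (inj₁ k′) = contradiction k′ (independent k mv)
      reply mv (inj₂ (u′ , v′ , mv′ , k′)) =
        isN u′ v′ mv′ (go (rec (<-trans (Move-decreasing mv′) (Move-decreasing mv))) k′)

  IsP⇒kernel : ∀ {x y} → IsP x y → K x y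
  IsP⇒kernel {x} {y} (isP allN) with absorbing x y
  ... | inj₁ k = k
  ... | inj₂ (u , v , mv , k) = contradiction (allN u v mv) (IsP⇒¬IsN (kernel⇒IsP k))

-- The recursion defining g

Follows : ℕ → ℕ → Set
Follows n m = ⌊ n φ⌋ ≡ suc ⌊ m φ+1⌋

follows? : ∀ n → Dec (∃[ m ] Follows n m)
follows? n = map′ (λ (m , _ , f) → m , f) (λ (m , f) → m , bound f , f)
                  (anyUpTo? (λ m → ⌊ n φ⌋ ≟ suc ⌊ m φ+1⌋) (suc ⌊ n φ⌋))
  where
  bound : ∀ {m} → Follows n m → m < suc ⌊ n φ⌋
  bound {m} f = s≤s (subst (m ≤_) (sym f) (m≤n⇒m≤1+n (m≤n+m m ⌊ m φ⌋)))

1∸-bit : ∀ c → 1 ∸ c ≡ 0 ⊎ 1 ∸ c ≡ 1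
1∸-bit zero    = inj₂ refl
1∸-bit (suc c) = inj₁ (0∸n≡0 c)

+-bit0 : ∀ x {c} → c ≡ 0 → x + c ≡ x
+-bit0 x refl = +-identityʳ x

+-bit1 : ∀ x {c} → c ≡ 1 → x + c ≡ suc x
+-bit1 x refl = +-comm x 1

3≤⌊⌋⇒2≤ : ∀ {n} → 3 ≤ ⌊ n φ⌋ → 2 ≤ n
3≤⌊⌋⇒2≤ {zero}        ()
3≤⌊⌋⇒2≤ {suc zero}    (s≤s ())
3≤⌊⌋⇒2≤ {suc (suc n)} _ = s≤s (s≤s z≤n)

3≤⌊⌋+1⇒2≤ : ∀ {m} → 3 ≤ ⌊ m φ+1⌋ → 2 ≤ m
3≤⌊⌋+1⇒2≤ {zero}        ()
3≤⌊⌋+1⇒2≤ {suc zero}    (s≤s (s≤s ()))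
3≤⌊⌋+1⇒2≤ {suc (suc m)} _ = s≤s (s≤s z≤n)

module WithG (g : ℕ → ℕ) (isG : IsG g) where

  g0≡1 : g 0 ≡ 1
  g0≡1 = proj₁ isG

  g1≡0 : g 1 ≡ 0
  g1≡0 = proj₁ (proj₂ isG)

  g-flip : ∀ {n m} → 2 ≤ n → Follows n m → g n ≡ 1 ∸ g m
  g-flip {n} {m} 2≤n f = proj₁ (proj₂ (proj₂ isG) n 2≤n) m (trans f (+-comm 1 _))

  g-default : ∀ {n} → 2 ≤ n → ¬ (∃[ m ] Follows n m) → g n ≡ 1
  g-default {n} 2≤n none =
    proj₂ (proj₂ (proj₂ isG) n 2≤n) λ m f → none (m , trans f (+-comm _ 1))

  g-bit : ∀ n → g n ≡ 0 ⊎ g n ≡ 1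
  g-bit zero             = inj₂ g0≡1
  g-bit (suc zero)       = inj₁ g1≡0
  g-bit n@(suc (suc _)) with follows? n
  ... | no none     = inj₂ (g-default (s≤s (s≤s z≤n)) none)
  ... | yes (m , f) = Sum.map (trans flip) (trans flip) (1∸-bit (g m))
    where flip = g-flip (s≤s (s≤s z≤n)) f

  g≡0⇔ : ∀ {n} → 2 ≤ n → g n ≡ 0 ⇔ (∃[ m ] Follows n m × g m ≡ 1)
  g≡0⇔ {n} 2≤n = mk⇔ witness λ (m , f , gm≡1) → trans (g-flip 2≤n f) (cong (1 ∸_) gm≡1)
    where
    witness : g n ≡ 0 → ∃[ m ] Follows n m × g m ≡ 1
    witness gn≡0 with follows? n
    ... | no none = contradiction (trans (sym gn≡0) (g-default 2≤n none)) 0≢1+n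
    ... | yes (m , f) with g-bit m
    ...   | inj₂ gm≡1 = m , f , gm≡1
    ...   | inj₁ gm≡0 =
      contradiction (trans (sym gn≡0) (trans (g-flip 2≤n f) (cong (1 ∸_) gm≡0))) 0≢1+n

  follower-≥2 : ∀ {n m} → 2 ≤ n → Follows n m → g m ≡ 1 → 2 ≤ m
  follower-≥2 {m = zero}        2≤n f _    = contradiction (sym f) (<⇒≢ (⌊⌋-strictMono 2≤n))
  follower-≥2 {m = suc zero}    _   _ g1≡1 = contradiction (trans (sym g1≡0) g1≡1) 0≢1+n
  follower-≥2 {m = suc (suc m)} _   _ _    = s≤s (s≤s z≤n)

  α β : ℕ → ℕ
  α n = ⌊ n φ⌋ + g n
  β n = ⌊ n φ+1⌋ + g n

  -- P₁,₁ of the paper is {(α n − 1, β n)}; Pair states suc x ≡ α n to avoid truncated subtraction.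
  Pair : ℕ → ℕ → ℕ → Set
  Pair n x y = (suc x ≡ α n) × (y ≡ β n)

  β≡α+n : ∀ n → β n ≡ α n + n
  β≡α+n n = xy∙z≈xz∙y ⌊ n φ⌋ n (g n)

  Pair⇒gap : ∀ {n x y} → Pair n x y → y ≡ x + suc n
  Pair⇒gap {n} {x} {y} (x+1≡α , y≡β) = begin
    y            ≡⟨ y≡β ⟩
    β n          ≡⟨ β≡α+n n ⟩
    α n + n      ≡⟨ cong (_+ n) (sym x+1≡α) ⟩
    suc x + n    ≡⟨ sym (+-suc x n) ⟩
    x + suc n    ∎
    where open ≡-Reasoning

  α-step : ∀ {n} → 2 ≤ n → α n < α (suc n)
  α-step {n} 2≤n with g-bit n | g-bit (suc n)
  ... | inj₁ gn≡0 | _ = begin-strict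
        α n            ≡⟨ +-bit0 ⌊ n φ⌋ gn≡0 ⟩
        ⌊ n φ⌋         <⟨ ⌊⌋-suc n ⟩
        ⌊ suc n φ⌋     ≤⟨ m≤m+n _ _ ⟩
        α (suc n)      ∎
    where open ≤-Reasoning
  ... | inj₂ gn≡1 | inj₂ gn+1≡1 =
        subst₂ _<_ (sym (+-bit1 _ gn≡1)) (sym (+-bit1 _ gn+1≡1)) (s≤s (⌊⌋-suc n))
  ... | inj₂ gn≡1 | inj₁ gn+1≡0 =
        subst₂ _<_ (sym (+-bit1 _ gn≡1)) (sym (+-bit0 _ gn+1≡0)) (≤∧≢⇒< (⌊⌋-suc n) not-adjacent)
    where
    -- g (n + 1) = 0 means ⌊(n + 1)φ⌋ directly follows some ⌊m(φ + 1)⌋, which then cannot be ⌊nφ⌋.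
    not-adjacent : suc ⌊ n φ⌋ ≢ ⌊ suc n φ⌋
    not-adjacent eq with to (g≡0⇔ (≤-trans 2≤n (n≤1+n n))) gn+1≡0
    ... | m , f , _ = beatty-disjoint {n} {m} (≤-trans (s≤s z≤n) 2≤n) (suc-injective (trans eq f))

  α-strictMono : ∀ {m n} → 2 ≤ m → m < n → α m < α n
  α-strictMono = stepwise⇒strictMono α α-step

  α-injective : ∀ {m n} → 2 ≤ m → 2 ≤ n → α m ≡ α n → m ≡ n
  α-injective = strictMono⇒injective α α-strictMono

  β-injective : ∀ {m n} → 2 ≤ m → 2 ≤ n → β m ≡ β n → m ≡ n
  β-injective = strictMono⇒injective β β-strictMono
    where
    β-strictMono : ∀ {m n} → 2 ≤ m → m < n → β m < β n
    β-strictMono {m} {n} 2≤m m<n =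
      subst₂ _<_ (sym (β≡α+n m)) (sym (β≡α+n n)) (+-mono-< (α-strictMono 2≤m m<n) m<n)

  α2≡4 : α 2 ≡ 4
  α2≡4 = cong (3 +_) (trans (g-flip ≤-refl refl) (cong (1 ∸_) g1≡0))

  4≤α : ∀ {n} → 2 ≤ n → 4 ≤ α n
  4≤α {n} 2≤n with m≤n⇒m<n∨m≡n 2≤n
  ... | inj₁ 2<n  = <⇒≤ (subst (_< α n) α2≡4 (α-strictMono ≤-refl 2<n))
  ... | inj₂ refl = ≤-reflexive (sym α2≡4)

  ⌊⌋+1≡β⇒ : ∀ {m′ m} → ⌊ m′ φ+1⌋ ≡ β m → m′ ≡ m × g m ≡ 0
  ⌊⌋+1≡β⇒ {m′} {m} eq with g-bit m
  ... | inj₁ gm≡0 = ⌊⌋+1-injective (trans eq (+-bit0 _ gm≡0)) , gm≡0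
  ... | inj₂ gm≡1 = contradiction (trans eq (+-bit1 _ gm≡1)) (⌊⌋+1≢suc m m′)

  ⌊⌋≢β : ∀ {n m} → 2 ≤ n → g n ≡ 1 → ⌊ n φ⌋ ≢ β m
  ⌊⌋≢β {n} {m} 2≤n gn≡1 eq with g-bit m
  ... | inj₁ gm≡0 = beatty-disjoint {n} {m} (≤-trans (s≤s z≤n) 2≤n) (trans eq (+-bit0 _ gm≡0))
  ... | inj₂ gm≡1 = 0≢1+n (trans (sym (from (g≡0⇔ 2≤n) (m , follows , gm≡1))) gn≡1)
    where follows = trans eq (+-bit1 _ gm≡1)

  α≢suc-β : ∀ {n m} → 2 ≤ n → α n ≢ suc (β m)
  α≢suc-β {n} {m} 2≤n eq with g-bit n
  ... | inj₂ gn≡1 = ⌊⌋≢β 2≤n gn≡1 (suc-injective (trans (sym (+-bit1 _ gn≡1)) eq))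
  ... | inj₁ gn≡0 with to (g≡0⇔ 2≤n) gn≡0
  ...   | m′ , f , gm′≡1
          with ⌊⌋+1≡β⇒ {m′} (suc-injective (trans (sym f) (trans (sym (+-bit0 _ gn≡0)) eq)))
  ...     | refl , gm≡0 = 0≢1+n (trans (sym gm≡0) gm′≡1)

  pair-cross : ∀ {n m x y u} → 2 ≤ n → Pair n x y → Pair m u x → ⊥
  pair-cross 2≤n (x+1≡αn , _) (_ , x≡βm) = α≢suc-β 2≤n (trans (sym x+1≡αn) (cong suc x≡βm))

  pair-cover : ∀ {x} → 3 ≤ x → ∃[ n ] 2 ≤ n × (suc x ≡ α n ⊎ x ≡ β n)
  pair-cover {x} 3≤x with beatty-cover (≤-trans (s≤s z≤n) 3≤x)
  ... | inj₁ (n , an≡x) with 3≤⌊⌋⇒2≤ (subst (3 ≤_) (sym an≡x) 3≤x) | g-bit n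
  ...   | 2≤n | inj₂ gn≡1 = n , 2≤n , inj₁ (sym (trans (+-bit1 _ gn≡1) (cong suc an≡x)))
  ...   | 2≤n | inj₁ gn≡0 with to (g≡0⇔ 2≤n) gn≡0
  ...     | m , f , gm≡1 =
            m , follower-≥2 2≤n f gm≡1 , inj₂ (trans (sym an≡x) (trans f (sym (+-bit1 _ gm≡1))))
  pair-cover {x} 3≤x | inj₂ (m , bm≡x) with 3≤⌊⌋+1⇒2≤ (subst (3 ≤_) (sym bm≡x) 3≤x) | g-bit m
  ...   | 2≤m | inj₁ gm≡0 = m , 2≤m , inj₂ (trans (sym bm≡x) (sym (+-bit0 _ gm≡0)))
  ...   | 2≤m | inj₂ gm≡1 with beatty-cover {suc x} (s≤s z≤n)
  ...     | inj₂ (m′ , bm′≡x+1) = contradiction (trans bm′≡x+1 (cong suc (sym bm≡x))) (⌊⌋+1≢suc m m′)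
  ...     | inj₁ (n , an≡x+1) = n , 2≤n , inj₁ (sym (trans (+-bit0 _ gn≡0) an≡x+1))
    where
    2≤n = 3≤⌊⌋⇒2≤ (subst (3 ≤_) (sym an≡x+1) (m≤n⇒m≤1+n 3≤x))
    gn≡0 = from (g≡0⇔ 2≤n) (m , trans an≡x+1 (cong suc (sym bm≡x)) , gm≡1)

  Kernel : ℕ → ℕ → Set
  Kernel x y = x + y ≤ 2 ⊎ (∃[ n ] 2 ≤ n × Pair n x y) ⊎ (∃[ n ] 2 ≤ n × Pair n y x)

  Kernel-sym : ∀ {x y} → Kernel x y → Kernel y x
  Kernel-sym {x} {y} (inj₁ small)   = inj₁ (subst (_≤ 2) (+-comm x y) small)
  Kernel-sym         (inj₂ (inj₁ p)) = inj₂ (inj₂ p)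
  Kernel-sym         (inj₂ (inj₂ p)) = inj₂ (inj₁ p)

  Pair⇒< : ∀ {n x y} → Pair n x y → x < y
  Pair⇒< {x = x} p = subst (x <_) (sym (Pair⇒gap p)) (m<m+n x (s≤s z≤n))

  Pair⇒3≤ : ∀ {n x y} → 2 ≤ n → Pair n x y → 3 ≤ x
  Pair⇒3≤ 2≤n (x+1≡α , _) = ≤-pred (subst (4 ≤_) (sym x+1≡α) (4≤α 2≤n))

  pair-independent : ∀ {n x y u v} → 2 ≤ n → Pair n x y → Move x y u v → ¬ Kernel u v
  pair-independent {y = y} 2≤n p (horiz {u = u} _ u<x) (inj₁ small) =
    <⇒≱ (≤-trans (≤-trans (Pair⇒3≤ 2≤n p) (<⇒≤ (Pair⇒< p))) (m≤n+m y u)) small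
  pair-independent 2≤n p (horiz _ u<x) (inj₂ (inj₁ (m , 2≤m , q))) =
    <-irrefl (suc-injective (trans (proj₁ q) (trans (cong α m≡n) (sym (proj₁ p))))) u<x
    where m≡n = β-injective 2≤m 2≤n (trans (sym (proj₂ q)) (proj₂ p))
  pair-independent 2≤n p (horiz _ _) (inj₂ (inj₂ (m , 2≤m , q))) = pair-cross 2≤m q p
  pair-independent {x = x} 2≤n p (vert {v = v} _ _) (inj₁ small) =
    <⇒≱ (≤-trans (Pair⇒3≤ 2≤n p) (m≤m+n x v)) small
  pair-independent 2≤n p (vert _ v<y) (inj₂ (inj₁ (m , 2≤m , q))) =
    <-irrefl (trans (proj₂ q) (trans (cong β m≡n) (sym (proj₂ p)))) v<y
    where m≡n = α-injective 2≤m 2≤n (trans (sym (proj₁ q)) (proj₁ p))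
  pair-independent 2≤n p (vert _ _) (inj₂ (inj₂ (_ , _ , q))) = pair-cross 2≤n p q
  pair-independent {n} {x} {y} 2≤n p (diag {t = t} _ 1≤t t≤x _) k = diagonal k
    where
    shifted-gap : y ∸ t ≡ (x ∸ t) + suc n
    shifted-gap = trans (cong (_∸ t) (Pair⇒gap p)) (+-∸-comm (suc n) t≤x)
    diagonal : ¬ Kernel (x ∸ t) (y ∸ t)
    diagonal (inj₁ small) = <⇒≱ (≤-trans (≤-trans (s≤s 2≤n) (m≤n+m (suc n) (x ∸ t)))
                                   (subst (_≤ (x ∸ t) + (y ∸ t)) shifted-gap (m≤n+m (y ∸ t) (x ∸ t)))) small
    diagonal (inj₂ (inj₁ (m , _ , q))) =
      <-irrefl (suc-injective (trans (proj₁ q) (trans (cong α m≡n) (sym (proj₁ p)))))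
               (∸-monoʳ-< {x} {t} {0} 1≤t t≤x)
      where m≡n = suc-injective (+-cancelˡ-≡ (x ∸ t) _ _ (trans (sym (Pair⇒gap q)) shifted-gap))
    diagonal (inj₂ (inj₂ (m , _ , q))) =
      <-irrefl (trans (Pair⇒gap q) (cong (_+ suc m) shifted-gap))
               (≤-trans (m<m+n (x ∸ t) (s≤s z≤n)) (m≤m+n ((x ∸ t) + suc n) (suc m)))

  independent : Independent Kernel
  independent (inj₁ small) mv _ = <⇒≱ (Move⇒2< mv) small
  independent (inj₂ (inj₁ (n , 2≤n , p))) mv = pair-independent 2≤n p mv
  independent (inj₂ (inj₂ (n , 2≤n , p))) mv k = pair-independent 2≤n p (Move-sym mv) (Kernel-sym k)

  A : ℕ → ℕ
  A n = pred (α n)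

  Pair-A-β : ∀ {n} → 2 ≤ n → Pair n (A n) (β n)
  Pair-A-β {n} 2≤n = suc-pred (α n) {{>-nonZero (≤-trans (s≤s z≤n) (4≤α 2≤n))}} , refl

  diagonal-reply : ∀ {n x y} → 2 ≤ n → suc x ≡ α n → x ≤ y → y < β n → 2 < x + y →
                   MovesInto Kernel x y
  diagonal-reply {n} {x} {y} 2≤n x+1≡αn x≤y y<βn big with y ∸ x ≤? 2
  ... | yes d≤2 = 0 , y ∸ x , diag-move big 1≤x refl (trans (+-comm (y ∸ x) x) x+d≡y) , inj₁ d≤2
    where
    1≤x = ≤-trans (s≤s z≤n) (Pair⇒3≤ 2≤n (x+1≡αn , refl))
    x+d≡y = m+[n∸m]≡n x≤y
  ... | no d≰2 = A m , β m , diag-move big (m<n⇒0<n∸m Am<x) (m+[n∸m]≡n (<⇒≤ Am<x)) βm+t≡y ,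
                 inj₂ (inj₁ (m , 2≤m , Pair-A-β 2≤m))
    where
    d = y ∸ x
    m = pred d
    x+d≡y : x + d ≡ y
    x+d≡y = m+[n∸m]≡n x≤y
    m+1≡d : suc m ≡ d
    m+1≡d = suc-pred d {{>-nonZero (≤-trans (s≤s z≤n) (≰⇒> d≰2))}}
    2≤m : 2 ≤ m
    2≤m = ≤-pred (subst (3 ≤_) (sym m+1≡d) (≰⇒> d≰2))
    m<n : m < n
    m<n = ≤-pred (subst (_< suc n) (sym m+1≡d)
            (+-cancelˡ-< x d (suc n) (subst₂ _<_ (sym x+d≡y) (Pair⇒gap (x+1≡αn , refl)) y<βn)))
    Am<x : A m < x
    Am<x = ≤-pred (subst₂ _<_ (sym (proj₁ (Pair-A-β 2≤m))) (sym x+1≡αn) (α-strictMono 2≤m m<n))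
    βm+t≡y : β m + (x ∸ A m) ≡ y
    βm+t≡y = begin
      β m + (x ∸ A m)
        ≡⟨ cong (_+ (x ∸ A m)) (trans (Pair⇒gap (Pair-A-β 2≤m)) (cong (A m +_) m+1≡d)) ⟩
      A m + d + (x ∸ A m)        ≡⟨ xy∙z≈xz∙y (A m) d (x ∸ A m) ⟩
      A m + (x ∸ A m) + d        ≡⟨ cong (_+ d) (m+[n∸m]≡n (<⇒≤ Am<x)) ⟩
      x + d                      ≡⟨ x+d≡y ⟩
      y                          ∎
      where open ≡-Reasoning

  absorbing-≤ : ∀ {x y} → x ≤ y → 2 < x + y → Kernel x y ⊎ MovesInto Kernel x y
  absorbing-≤ {x} {y} x≤y big with x ≤? 2
  ... | yes x≤2 = inj₂ (x , 0 , vert big 0<y , inj₁ x+0≤2)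
    where
    x+0≤2 = subst (_≤ 2) (sym (+-identityʳ x)) x≤2
    0<y = n≢0⇒n>0 λ { refl → <⇒≱ big x+0≤2 }
  ... | no x≰2 with pair-cover (≰⇒> x≰2)
  ...   | n , 2≤n , inj₂ x≡βn =
          inj₂ (x , A n , vert big An<y , inj₂ (inj₂ (n , 2≤n , proj₁ (Pair-A-β 2≤n) , x≡βn)))
    where An<y = <-≤-trans (subst (A n <_) (sym x≡βn) (Pair⇒< (Pair-A-β 2≤n))) x≤y
  ...   | n , 2≤n , inj₁ x+1≡αn with <-cmp y (β n)
  ...     | tri< y<βn _ _ = inj₂ (diagonal-reply 2≤n x+1≡αn x≤y y<βn big)
  ...     | tri≈ _ y≡βn _ = inj₁ (inj₂ (inj₁ (n , 2≤n , x+1≡αn , y≡βn)))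
  ...     | tri> _ _ βn<y = inj₂ (x , β n , vert big βn<y , inj₂ (inj₁ (n , 2≤n , x+1≡αn , refl)))

  absorbing : Absorbing Kernel
  absorbing x y with x + y ≤? 2 | x ≤? y
  ... | yes small | _       = inj₁ (inj₁ small)
  ... | no big    | yes x≤y = absorbing-≤ x≤y (≰⇒> big)
  ... | no big    | no x≰y  =
        Sum.map Kernel-sym (λ (u , v , mv , k) → v , u , Move-sym mv , Kernel-sym k)
                (absorbing-≤ (<⇒≤ (≰⇒> x≰y)) (subst (2 <_) (+-comm x y) (≰⇒> big)))

  Pair⇒Kernel : ∀ {n x y} → Pair n x y → Kernel x y
  Pair⇒Kernel {zero} (x+1≡g0 , y≡g0) =
    inj₁ (subst₂ (λ a b → a + b ≤ 2) (sym (suc-injective (trans x+1≡g0 g0≡1))) (sym (trans y≡g0 g0≡1))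
                 (s≤s z≤n))
  Pair⇒Kernel {suc zero} (x+1≡1+g1 , y≡2+g1) =
    inj₁ (subst₂ (λ a b → a + b ≤ 2) (sym (suc-injective (trans x+1≡1+g1 (cong suc g1≡0))))
                 (sym (trans y≡2+g1 (cong (2 +_) g1≡0))) ≤-refl)
  Pair⇒Kernel {suc (suc n)} p = inj₂ (inj₁ (suc (suc n) , s≤s (s≤s z≤n) , p))

  small⇒InP1 : ∀ x y → x + y ≤ 2 → InP1 g x y
  small⇒InP1 0 0 _ = inj₂ (inj₂ (inj₁ (refl , refl)))
  small⇒InP1 1 1 _ = inj₂ (inj₂ (inj₂ (refl , refl)))
  small⇒InP1 0 1 _ = inj₁ (0 , sym g0≡1 , sym g0≡1)
  small⇒InP1 1 0 _ = inj₂ (inj₁ (0 , sym g0≡1 , sym g0≡1))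
  small⇒InP1 0 2 _ = inj₁ (1 , sym (cong (1 +_) g1≡0) , sym (cong (2 +_) g1≡0))
  small⇒InP1 2 0 _ = inj₂ (inj₁ (1 , sym (cong (2 +_) g1≡0) , sym (cong (1 +_) g1≡0)))
  small⇒InP1 0 (suc (suc (suc _))) (s≤s (s≤s ()))
  small⇒InP1 1 (suc (suc _))       (s≤s (s≤s ()))
  small⇒InP1 2 (suc _)             (s≤s (s≤s ()))
  small⇒InP1 (suc (suc (suc _))) _ (s≤s (s≤s ()))

  Kernel⇔InP1 : ∀ {x y} → Kernel x y ⇔ InP1 g x y
  Kernel⇔InP1 {x} {y} = mk⇔ toInP1 fromInP1
    where
    toInP1 : Kernel x y → InP1 g x y
    toInP1 (inj₁ small) = small⇒InP1 x y small
    toInP1 (inj₂ (inj₁ (n , _ , x+1≡αn , y≡βn))) = inj₁ (n , trans (+-comm x 1) x+1≡αn , y≡βn)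
    toInP1 (inj₂ (inj₂ (n , _ , y+1≡αn , x≡βn))) = inj₂ (inj₁ (n , x≡βn , trans (+-comm y 1) y+1≡αn))
    fromInP1 : InP1 g x y → Kernel x y
    fromInP1 (inj₁ (_ , x+1≡αn , y≡βn)) = Pair⇒Kernel (trans (+-comm 1 x) x+1≡αn , y≡βn)
    fromInP1 (inj₂ (inj₁ (_ , x≡βn , y+1≡αn))) =
      Kernel-sym (Pair⇒Kernel (trans (+-comm 1 y) y+1≡αn , x≡βn))
    fromInP1 (inj₂ (inj₂ (inj₁ (refl , refl)))) = inj₁ z≤n
    fromInP1 (inj₂ (inj₂ (inj₂ (refl , refl)))) = inj₁ (s≤s (s≤s z≤n))

theorem3p13 : (g : ℕ → ℕ) → IsG g →
    ∀ x y → (IsP x y → InP1 g x y) × (InP1 g x y → IsP x y)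
theorem3p13 g isG x y =
  (λ p → to Kernel⇔InP1 (IsP⇒kernel independent absorbing p)) ,
  (λ q → kernel⇒IsP independent absorbing (from Kernel⇔InP1 q))
  where open WithG g isG
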